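{- Let $n\geq 2$ be finite, $\mathfrak A\in TA_n$, and let $f:\mathfrak A\to\wp(V)$ be an atomic representation of $\mathfrak A$. Then for every $Y\subseteq A$ with $\prod Y=0$ we have $\bigcap_{y\in Y}f(y)=\emptyset$.
   Context: A $TA_n$-type algebra is a Boolean algebra with unary operations $s_{ij}$, $i\neq j<n$. For a word $w=s_{i_1j_1}\cdots s_{i_kj_k}$ put $\hat w=[i_1,j_1]\circ\cdots\circ[i_k,j_k]\in S_n$, $[i,j]$ the transposition swapping $i,j$. $\Sigma_n$: Boolean algebra axioms; $s_{ij}(x\wedge y)=s_{ij}x\wedge s_{ij}y$; $s_{ij}(-x)=-s_{ij}x$; $w_1(x)=w_2(x)$ whenever $\hat w_1=\hat w_2$. $TA_n=\mathbf{Mod}(\Sigma_n)$. A set $V\subseteq{}^nU$ is permutable if $s\in V$ implies $s\circ[i,j]\in V$ for all $i\neq j<n$; $\wp(V)=\langle\mathcal P(V),\cap,-,S_{ij}\rangle$ with complement relative to $V$ and $S_{ij}(Y)=\{q\in V:q\circ[i,j]\in Y\}$. A representation is an injective homomorphism $f:\mathfrak A\to\wp(V)$ with $V$ permutable; it is atomic if for every $s\in V$ the ultrafilter $f^{ -1}(s)=\{a\in A:s\in f(a)\}$ is principal. -}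

module Defs where

open import Level using (Level; _⊔_) renaming (suc to lsuc)
open import Data.Nat using (ℕ)
open import Data.Fin using (Fin)
open import Data.Fin.Permutation.Components using (transpose)
open import Data.List using (List; []; _∷_)
open import Data.Product using (Σ; _×_; _,_; ∃)
open import Data.Empty renaming (⊥ to Empty)
open import Function using (_∘_; id)
open import Relation.Binary.PropositionalEquality using (_≡_; _≢_)
open import Relation.Unary using (Pred; _∈_)
open import Algebra.Lattice.Bundles using (BooleanAlgebra)

Letter : ℕ → Set
Letter n = Σ (Fin n) λ i → Σ (Fin n) λ j → i ≢ j

Word : ℕ → Set
Word n = List (Letter n)

hat : ∀ {n} → Word n → Fin n → Fin n
hat []                  = id
hat ((i , j , _) ∷ w)   = transpose i j ∘ hat w

_≗ₚ_ : ∀ {n} → (Fin n → Fin n) → (Fin n → Fin n) → Set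
σ ≗ₚ τ = ∀ k → σ k ≡ τ k

act : ∀ {n c} {A : Set c} → ((i j : Fin n) → i ≢ j → A → A) → Word n → A → A
act s []                x = x
act s ((i , j , p) ∷ w) x = s i j p (act s w x)

record TA (n : ℕ) (c ℓ : Level) : Set (lsuc (c ⊔ ℓ)) where
  field
    boolean : BooleanAlgebra c ℓ
  open BooleanAlgebra boolean public
  field
    s       : (i j : Fin n) → i ≢ j → Carrier → Carrier
    s-cong  : ∀ i j (p : i ≢ j) {x y} → x ≈ y → s i j p x ≈ s i j p y
    s-∧     : ∀ i j (p : i ≢ j) x y → s i j p (x ∧ y) ≈ (s i j p x ∧ s i j p y)
    s-¬     : ∀ i j (p : i ≢ j) x → s i j p (¬ x) ≈ ¬ (s i j p x)
  field
    s-word  : ∀ (w₁ w₂ : Word n) → hat w₁ ≗ₚ hat w₂ → ∀ x → act s w₁ x ≈ act s w₂ x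
  _≤_ : Carrier → Carrier → Set ℓ
  a ≤ b = (a ∧ b) ≈ a

Seq : ∀ {u} → ℕ → Set u → Set u
Seq n U = Fin n → U

Permutable : ∀ {u p} {n : ℕ} {U : Set u} → Pred (Seq n U) p → Set (u ⊔ p)
Permutable {n = n} V = ∀ {q} → q ∈ V → ∀ (i j : Fin n) → i ≢ j → (q ∘ transpose i j) ∈ V

-- Subsets of V are predicates
-- contained in V; equality of subsets is extensional (mutual inclusion).
record IsRepresentation {n c ℓ u p} (𝔄 : TA n c ℓ) {U : Set u}
         (V : Pred (Seq n U) p) (f : TA.Carrier 𝔄 → Pred (Seq n U) p)
         : Set (c ⊔ ℓ ⊔ u ⊔ p) where
  open TA 𝔄
  field
    permutable : Permutable V
    into-V     : ∀ a {q} → q ∈ f a → q ∈ V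
    f-cong     : ∀ {a b} → a ≈ b → ∀ q → (q ∈ f a → q ∈ f b) × (q ∈ f b → q ∈ f a)
    f-∧        : ∀ a b q → (q ∈ f (a ∧ b) → (q ∈ f a × q ∈ f b))
                         × ((q ∈ f a × q ∈ f b) → q ∈ f (a ∧ b))
    f-¬        : ∀ a q → (q ∈ f (¬ a) → (q ∈ V × (q ∈ f a → Empty)))
                       × ((q ∈ V × (q ∈ f a → Empty)) → q ∈ f (¬ a))
    f-s        : ∀ i j (r : i ≢ j) a q →
                   (q ∈ f (s i j r a) → (q ∈ V × (q ∘ transpose i j) ∈ f a))
                 × ((q ∈ V × (q ∘ transpose i j) ∈ f a) → q ∈ f (s i j r a))
    injective  : ∀ a b → (∀ q → (q ∈ f a → q ∈ f b) × (q ∈ f b → q ∈ f a)) → a ≈ b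

-- atomic: for every q ∈ V the ultrafilter f⁻¹(q) = {a : q ∈ f a} is principal,
-- i.e. of the form {b : g ≤ b} for some g ∈ A
IsAtomic : ∀ {n c ℓ u p} (𝔄 : TA n c ℓ) {U : Set u}
           (V : Pred (Seq n U) p) (f : TA.Carrier 𝔄 → Pred (Seq n U) p) → Set _
IsAtomic 𝔄 V f = ∀ q → q ∈ V → ∃ λ g → ∀ b → (q ∈ f b → g ≤ b) × (g ≤ b → q ∈ f b)
  where open TA 𝔄

MeetIsZero : ∀ {n c ℓ y} (𝔄 : TA n c ℓ) → Pred (TA.Carrier 𝔄) y → Set _
MeetIsZero 𝔄 Y = (∀ a → a ∈ Y → ⊥ ≤ a) × (∀ z → (∀ a → a ∈ Y → z ≤ a) → z ≈ ⊥)
  where open TA 𝔄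

module Submission where

-- Let f : 𝔄 → ℘(V) be an atomic representation and
-- suppose some q ∈ V lies in f(a) for every a ∈ Y.  Atomicity gives an
-- element g generating the ultrafilter f⁻¹(q) = {b : q ∈ f b}, i.e.
-- q ∈ f b ⇔ g ≤ b.  Hence g is a lower bound of Y, so g ≈ ⊥ because
-- ∏ Y = 0, and q ∈ f g (as g ≤ g) means q ∈ f ⊥.  But a representation
-- maps ⊥ to the empty set, since ⊥ ≈ a ∧ ¬a and f turns meets into
-- intersections and complements into complements relative to V.

open import Defs
open import Data.Nat using (ℕ; _≤_)
open import Data.Product using (∃; _×_; _,_; proj₁; proj₂)
open import Relation.Nullary using (¬_)
open import Relation.Unary using (Pred; _∈_)
import Algebra.Lattice.Properties.Lattice as LatticeProperties

module _ {n c ℓ u p} (𝔄 : TA n c ℓ) {U : Set u}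
         {V : Pred (Seq n U) p} {f : TA.Carrier 𝔄 → Pred (Seq n U) p}
         where

  -- The Boolean order of 𝔄 is written ≼ to keep it apart from ≤ on ℕ.
  open TA 𝔄 renaming (¬_ to ∁; _≤_ to _≼_)

  module _ (rep : IsRepresentation 𝔄 V f) where

    open IsRepresentation rep

    complement-disjoint : ∀ a q → q ∈ f a → ¬ (q ∈ f (∁ a))
    complement-disjoint a q q∈fa q∈f∁a = proj₂ (proj₁ (f-¬ a q) q∈f∁a) q∈fa

    -- A representation sends the bottom element to the empty set,
    -- because ⊥ ≈ ⊥ ∧ ¬⊥ and f(⊥ ∧ ¬⊥) = f(⊥) ∩ f(¬⊥) = ∅.
    bottom-empty : ∀ q → ¬ (q ∈ f ⊥)
    bottom-empty q q∈f⊥ = complement-disjoint ⊥ q q∈f⊥ (proj₂ in-both)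
      where
      q∈f[⊥∧∁⊥] : q ∈ f (⊥ ∧ ∁ ⊥)
      q∈f[⊥∧∁⊥] = proj₂ (f-cong (∧-complementʳ ⊥) q) q∈f⊥

      in-both : q ∈ f ⊥ × q ∈ f (∁ ⊥)
      in-both = proj₁ (f-∧ ⊥ (∁ ⊥) q) q∈f[⊥∧∁⊥]

  module _ (atomic : IsAtomic 𝔄 V f) {q} (q∈V : q ∈ V) where

    generator : Carrier
    generator = proj₁ (atomic q q∈V)

    generator-below : ∀ b → q ∈ f b → generator ≼ b
    generator-below b = proj₁ (proj₂ (atomic q q∈V) b)

    generator-contains : q ∈ f generator
    generator-contains =
      proj₂ (proj₂ (atomic q q∈V) generator) (LatticeProperties.∧-idem lattice generator)

mainTheorem7 : ∀ {c ℓ u p y} (n : ℕ) → 2 ≤ n → (𝔄 : TA n c ℓ) {U : Set u}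
    (V : Pred (Seq n U) p) (f : TA.Carrier 𝔄 → Pred (Seq n U) p) →
    IsRepresentation 𝔄 V f → IsAtomic 𝔄 V f →
    (Y : Pred (TA.Carrier 𝔄) y) → MeetIsZero 𝔄 Y →
    ¬ (∃ λ q → q ∈ V × (∀ a → a ∈ Y → q ∈ f a))
mainTheorem7 n _ 𝔄 V f rep atomic Y (_ , greatest) (q , q∈V , q∈⋂fY) =
  bottom-empty 𝔄 rep q q∈f⊥
  where
  open TA 𝔄 using (_≈_; ⊥)
  open IsRepresentation rep using (f-cong)

  -- The generator of f⁻¹(q) is a lower bound of Y, hence equals ∏ Y = 0.
  generator≈⊥ : generator 𝔄 atomic q∈V ≈ ⊥
  generator≈⊥ = greatest _ (λ a a∈Y → generator-below 𝔄 atomic q∈V a (q∈⋂fY a a∈Y))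

  q∈f⊥ : q ∈ f ⊥
  q∈f⊥ = proj₁ (f-cong generator≈⊥ q) (generator-contains 𝔄 atomic q∈V)
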